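{- Let $G$ be a connected simple undirected graph with $n$ vertices, let $\beta(G,n)$ be a coding sequence of $G$, and let $S\subseteq\beta(G,n)$. Then $G(S)$ is a spanning tree of $G$ if and only if $S$ is a basis of the vector space $\mathbb{Z}_2^{n-1}$ over $\mathbb{Z}_2$.
   Context: Coding sequences: for a simple graph $G=(V,E)$ with $n$ vertices, choose a labeling $V=\{v_0,\ldots,v_{n-1}\}$. For an edge $e=v_iv_j$ with $i>j$ let $f^\#(e)=(x_1,\ldots,x_{n-1})\in\mathbb{Z}_2^{n-1}$ with $x_k=1$ iff $n-i\le k\le n-j-1$ and $x_k=0$ otherwise. The coding sequence $\beta(G,n)$ for that labeling is $\{f^\#(e):e\in E\}$; every element lies in $C(n-1)$, the set of non-zero vectors whose $1$'s are in consecutive coordinates. For $S\subseteq C(n-1)$, $G(S)$ is the graph on vertex set $\{0,\dots,n-1\}$ (identified with $v_0,\dots,v_{n-1}$) in which each $e\in S$ whose $1$'s run from the $i$-th to the $j$-th coordinate (from the left) is an edge joining vertices $n-i$ and $n-j-1$; thus $G(S)$ is the spanning subgraph of $G$ with edge set corresponding to $S$. -}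

module Defs where

open import Data.Nat using (ℕ; zero; suc; _∸_; _≤ᵇ_)
open import Data.Bool using (Bool; true; false; _∧_; _xor_)
open import Data.Fin using (Fin; toℕ; _<_)
open import Data.Vec using (Vec; []; _∷_; tabulate; replicate; zipWith; map)
open import Data.List using (List; []; _∷_; _++_; [_]; length)
open import Data.List.Membership.Propositional using (_∈_)
open import Data.List.Relation.Unary.Linked using (Linked)
open import Data.List.Relation.Unary.All using (All)
open import Data.Product using (Σ; ∃; ∃-syntax; _×_)
open import Data.Sum using (_⊎_)
open import Data.Empty using (⊥)
open import Relation.Nullary using (¬_)
open import Relation.Binary.PropositionalEquality using (_≡_)
open import Relation.Binary.Construct.Closure.ReflexiveTransitive using (Star)
open import Function.Bundles using (_↔_; Inverse)
open import Level using (0ℓ)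

record SimpleGraph (V : Set) : Set₁ where
  field
    Adj    : V → V → Set
    sym    : ∀ {u v} → Adj u v → Adj v u
    irrefl : ∀ {v} → ¬ Adj v v
open SimpleGraph public

Connected : {V : Set} → (V → V → Set) → Set
Connected {V} R = (u v : V) → Star R u v

IsCycle : {V : Set} → (V → V → Set) → List V → Set
IsCycle R [] = ⊥
IsCycle R (_ ∷ []) = ⊥
IsCycle R (_ ∷ _ ∷ []) = ⊥
IsCycle R (v₀ ∷ v₁ ∷ v₂ ∷ vs) =
  Data.List.Relation.Unary.Unique.Propositional.Unique (v₀ ∷ v₁ ∷ v₂ ∷ vs)
  × Linked R ((v₀ ∷ v₁ ∷ v₂ ∷ vs) ++ [ v₀ ])
  where import Data.List.Relation.Unary.Unique.Propositional

Acyclic : {V : Set} → (V → V → Set) → Set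
Acyclic {V} R = (c : List V) → ¬ IsCycle R c

IsTree : {V : Set} → (V → V → Set) → Set
IsTree R = Connected R × Acyclic R

IsSpanningTreeOf : {V : Set} → (V → V → Set) → (V → V → Set) → Set
IsSpanningTreeOf {V} T A = (∀ (u v : V) → T u v → A u v) × IsTree T

-- Z₂^m as Vec Bool m (false = 0, true = 1, xor = addition)

Z2^ : ℕ → Set
Z2^ m = Vec Bool m

zeroV : ∀ {m} → Z2^ m
zeroV = replicate _ false

_⊕_ : ∀ {m} → Z2^ m → Z2^ m → Z2^ m
_⊕_ = zipWith _xor_

_·_ : ∀ {m} → Bool → Z2^ m → Z2^ m
c · v = map (c ∧_) v

lincomb : ∀ {m} (S : List (Z2^ m)) → Vec Bool (length S) → Z2^ m
lincomb []      []       = zeroV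
lincomb (s ∷ S) (c ∷ cs) = (c · s) ⊕ lincomb S cs

-- a finite set of vectors, given as a duplicate-free list, is a basis of Z₂^m
LinearlyIndependent : ∀ {m} → List (Z2^ m) → Set
LinearlyIndependent S =
  (c : Vec Bool (length S)) → lincomb S c ≡ zeroV → c ≡ replicate _ false

Spans : ∀ {m} → List (Z2^ m) → Set
Spans {m} S = (v : Z2^ m) → ∃[ c ] (lincomb S c ≡ v)

IsBasis : ∀ {m} → List (Z2^ m) → Set
IsBasis S = LinearlyIndependent S × Spans S

-- Coding sequences.  n = suc m vertices, labels Fin (suc m).

-- f^#(v_i v_j) for i > j : x_k = 1 iff n - i ≤ k ≤ n - j - 1,
-- coordinates k = 1 .. n-1 (coordinate k is the Fin index k-1).
fsharp : ∀ {m} → Fin (suc m) → Fin (suc m) → Z2^ m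
fsharp {m} i j =
  tabulate λ k → (suc m ∸ toℕ i ≤ᵇ suc (toℕ k)) ∧ (suc (toℕ k) ≤ᵇ m ∸ toℕ j)

LAdj : ∀ {V : Set} {n} → SimpleGraph V → (Fin n ↔ V) → Fin n → Fin n → Set
LAdj G σ i j = Adj G (Inverse.to σ i) (Inverse.to σ j)

InCoding : ∀ {V : Set} {m} → SimpleGraph V → (Fin (suc m) ↔ V) → Z2^ m → Set
InCoding G σ x = ∃[ i ] ∃[ j ] (j < i × LAdj G σ i j × x ≡ fsharp i j)

-- G(S): vertices 0..n-1; e ∈ S whose 1's run exactly over the coordinates
-- n-i .. n-j-1 (i.e. e = f^#(i,j), i > j) gives the edge i j
GS : ∀ {m} → List (Z2^ m) → Fin (suc m) → Fin (suc m) → Set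
GS S u v = (v < u × fsharp u v ∈ S) ⊎ (u < v × fsharp v u ∈ S)

module Submission where

-- Give vertex v the potential ω v ∈ Z₂^m whose last v coordinates are 1; then
-- f^#(v_i v_j) = ω i ⊕ ω j, so codes telescope along walks and a walk u → v in
-- G(S) puts ω u ⊕ ω v into span S.  Conversely a vertex colouring χ gives a
-- linear functional Φ χ with Φ χ (ω u ⊕ ω v) = χ u xor χ v; colouring the
-- component of u kills every code of S, hence span S, so ω u ⊕ ω v ∈ span S
-- joins u and v by a walk.  As unit vectors are codes of consecutive vertices,
-- G(S) is connected iff S spans.  Deleting an edge of a cycle leaves a walk
-- between its ends, so independence forbids cycles; a vector of S spanned by
-- the others yields a walk around its own edge, shortcut to a cycle, so
-- acyclicity gives independence.  Z₂-linear algebra, potentials, colourings,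
-- components and simple paths come first; the theorem combines them.

open import Defs hiding (sym)
open import Data.Nat using (ℕ; suc)
open import Data.Fin using (Fin)
open import Data.List using (List)
open import Data.List.Relation.Unary.All using (All)
open import Data.List.Relation.Unary.Unique.Propositional using (Unique)
open import Function.Bundles using (_↔_; _⇔_)

open import Level using (0ℓ)
open import Data.Nat as ℕ using (zero; _∸_; _≤ᵇ_; _<ᵇ_)
import Data.Nat.Properties as ℕₚ
open import Data.Bool using (Bool; true; false; _∧_; _xor_; not; if_then_else_)
open import Data.Bool.Properties
  using (xor-assoc; xor-comm; xor-same; xor-identityˡ; xor-identityʳ; ∧-zeroʳ; xor-∧-commutativeRing; T-≡)
open import Data.Maybe using (nothing)
open import Data.Fin using (toℕ; fromℕ; inject₁; opposite; _<_; _≟_)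
import Data.Fin.Properties as Finₚ
open import Data.Vec using (Vec; []; _∷_; replicate; lookup; tail)
import Data.Vec.Properties as Vecₚ
open import Data.List using ([]; _∷_; _++_; [_]; length)
open import Data.List.Membership.Propositional using (_∈_; _∉_)
open import Data.List.Membership.Propositional.Properties using (∈-++⁻; ∈-++⁺ˡ; ∈-++⁺ʳ; ∈-insert; ∈-∃++)
open import Data.List.Relation.Binary.Subset.Propositional using (_⊆_)
open import Data.List.Relation.Unary.Any using (here; there; any?)
import Data.List.Relation.Unary.All as All
open import Data.List.Relation.Unary.All using ([]; _∷_)
open import Data.List.Relation.Unary.All.Properties using (¬Any⇒All¬)
open import Data.List.Relation.Unary.AllPairs using ([]; _∷_)
open import Data.List.Relation.Unary.Linked using (Linked; [-]; _∷_)
open import Data.Product using (∃-syntax; _×_; _,_; proj₁; proj₂; uncurry)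
open import Data.Sum using (_⊎_; inj₁; inj₂)
open import Data.Empty using (⊥-elim)
open import Function using (_∘_; id)
open import Function.Bundles using (mk⇔; Equivalence)
open import Relation.Nullary using (¬_; Dec; yes; no; does)
open import Relation.Nullary.Decidable using (dec-true; dec-false)
open import Relation.Binary using (tri<; tri≈; tri>; DecidableEquality)
open import Relation.Binary.PropositionalEquality
  using (_≡_; _≢_; refl; sym; trans; cong; cong₂; subst; ≢-sym; module ≡-Reasoning)
open import Relation.Binary.Construct.Closure.ReflexiveTransitive using (Star; ε; _◅_; _◅◅_)
open import Tactic.RingSolver using (solve-∀)
open import Tactic.RingSolver.Core.AlmostCommutativeRing using (AlmostCommutativeRing; fromCommutativeRing)

open ≡-Reasoning

ℤ₂ : AlmostCommutativeRing 0ℓ 0ℓ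
ℤ₂ = fromCommutativeRing xor-∧-commutativeRing (λ _ → nothing)

xor-∧-interchange : ∀ a b s x y → ((a ∧ s) xor x) xor ((b ∧ s) xor y) ≡ ((a xor b) ∧ s) xor (x xor y)
xor-∧-interchange = solve-∀ ℤ₂

∧-factor : ∀ c a d x → ((c ∧ a) ∧ d) xor (c ∧ x) ≡ c ∧ ((a ∧ d) xor x)
∧-factor = solve-∀ ℤ₂

xor-telescope : ∀ a b c → (a xor b) xor (b xor c) ≡ a xor c
xor-telescope a b c = begin
  (a xor b) xor (b xor c)  ≡⟨ xor-assoc a b (b xor c) ⟩
  a xor (b xor (b xor c))  ≡⟨ cong (a xor_) (sym (xor-assoc b b c)) ⟩
  a xor ((b xor b) xor c)  ≡⟨ cong (λ t → a xor (t xor c)) (xor-same b) ⟩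
  a xor c                  ∎

xor-false⇒≡ : ∀ a b → a xor b ≡ false → a ≡ b
xor-false⇒≡ true  true  _ = refl
xor-false⇒≡ false false _ = refl
xor-false⇒≡ true  false ()
xor-false⇒≡ false true  ()

xor-true : ∀ a b → a xor b ≡ true → a ≡ true ⊎ b ≡ true
xor-true true  _ _ = inj₁ refl
xor-true false _ e = inj₂ e

-- the indicator of an interval [p, q) is the difference of two step indicators
∧-not≡xor : ∀ a b → (b ≡ true → a ≡ true) → a ∧ not b ≡ a xor b
∧-not≡xor true  true  _ = refl
∧-not≡xor true  false _ = refl
∧-not≡xor false true  h with h refl
... | ()
∧-not≡xor false false _ = refl

witness : ∀ {A : Set} (d : Dec A) → does d ≡ true → A
witness (yes a) _ = a

⊕-assoc : ∀ {m} (x y z : Z2^ m) → (x ⊕ y) ⊕ z ≡ x ⊕ (y ⊕ z)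
⊕-assoc = Vecₚ.zipWith-assoc xor-assoc

⊕-comm : ∀ {m} (x y : Z2^ m) → x ⊕ y ≡ y ⊕ x
⊕-comm = Vecₚ.zipWith-comm xor-comm

⊕-identityˡ : ∀ {m} (x : Z2^ m) → zeroV ⊕ x ≡ x
⊕-identityˡ = Vecₚ.zipWith-identityˡ xor-identityˡ

⊕-identityʳ : ∀ {m} (x : Z2^ m) → x ⊕ zeroV ≡ x
⊕-identityʳ = Vecₚ.zipWith-identityʳ xor-identityʳ

⊕-self : ∀ {m} (x : Z2^ m) → x ⊕ x ≡ zeroV
⊕-self []      = refl
⊕-self (a ∷ x) = cong₂ _∷_ (xor-same a) (⊕-self x)

⊕-cancel : ∀ {m} (x y : Z2^ m) → x ⊕ y ≡ zeroV → x ≡ y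
⊕-cancel x y x⊕y≡0 = begin
  x              ≡⟨ sym (⊕-identityʳ x) ⟩
  x ⊕ zeroV      ≡⟨ cong (x ⊕_) (sym (⊕-self y)) ⟩
  x ⊕ (y ⊕ y)    ≡⟨ sym (⊕-assoc x y y) ⟩
  (x ⊕ y) ⊕ y    ≡⟨ cong (_⊕ y) x⊕y≡0 ⟩
  zeroV ⊕ y      ≡⟨ ⊕-identityˡ y ⟩
  y              ∎

⊕-telescope : ∀ {m} (x y z : Z2^ m) → (x ⊕ y) ⊕ (y ⊕ z) ≡ x ⊕ z
⊕-telescope x y z = begin
  (x ⊕ y) ⊕ (y ⊕ z)  ≡⟨ ⊕-assoc x y (y ⊕ z) ⟩
  x ⊕ (y ⊕ (y ⊕ z))  ≡⟨ cong (x ⊕_) (sym (⊕-assoc y y z)) ⟩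
  x ⊕ ((y ⊕ y) ⊕ z)  ≡⟨ cong (λ t → x ⊕ (t ⊕ z)) (⊕-self y) ⟩
  x ⊕ (zeroV ⊕ z)    ≡⟨ cong (x ⊕_) (⊕-identityˡ z) ⟩
  x ⊕ z              ∎

⊕-swap : ∀ {m} (x y z : Z2^ m) → x ⊕ (y ⊕ z) ≡ y ⊕ (x ⊕ z)
⊕-swap x y z = begin
  x ⊕ (y ⊕ z)  ≡⟨ sym (⊕-assoc x y z) ⟩
  (x ⊕ y) ⊕ z  ≡⟨ cong (_⊕ z) (⊕-comm x y) ⟩
  (y ⊕ x) ⊕ z  ≡⟨ ⊕-assoc y x z ⟩
  y ⊕ (x ⊕ z)  ∎

·-zero : ∀ {m} (x : Z2^ m) → false · x ≡ zeroV
·-zero []      = refl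
·-zero (_ ∷ x) = cong (false ∷_) (·-zero x)

·-one : ∀ {m} (x : Z2^ m) → true · x ≡ x
·-one x = trans (Vecₚ.map-cong (λ _ → refl) x) (Vecₚ.map-id x)

·⊕-interchange : ∀ {m} a b (s x y : Z2^ m) → ((a · s) ⊕ x) ⊕ ((b · s) ⊕ y) ≡ ((a xor b) · s) ⊕ (x ⊕ y)
·⊕-interchange a b []      []      []      = refl
·⊕-interchange a b (s ∷ ss) (x ∷ xs) (y ∷ ys) =
  cong₂ _∷_ (xor-∧-interchange a b s x y) (·⊕-interchange a b ss xs ys)

lincomb-⊕ : ∀ {m} (S : List (Z2^ m)) c d → lincomb S c ⊕ lincomb S d ≡ lincomb S (c ⊕ d)
lincomb-⊕ []      []      []      = ⊕-self zeroV
lincomb-⊕ (s ∷ S) (a ∷ c) (b ∷ d) =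
  trans (·⊕-interchange a b s (lincomb S c) (lincomb S d)) (cong (((a xor b) · s) ⊕_) (lincomb-⊕ S c d))

Span : ∀ {m} → List (Z2^ m) → Z2^ m → Set
Span S x = ∃[ c ] (lincomb S c ≡ x)

lincomb-zero : ∀ {m} (S : List (Z2^ m)) → lincomb S (replicate _ false) ≡ zeroV
lincomb-zero []      = refl
lincomb-zero (s ∷ S) = trans (cong₂ _⊕_ (·-zero s) (lincomb-zero S)) (⊕-self zeroV)

span-zero : ∀ {m} (S : List (Z2^ m)) → Span S zeroV
span-zero S = replicate _ false , lincomb-zero S

span-⊕ : ∀ {m} (S : List (Z2^ m)) x y → Span S x → Span S y → Span S (x ⊕ y)
span-⊕ S x y (c , c↦x) (d , d↦y) = c ⊕ d , trans (sym (lincomb-⊕ S c d)) (cong₂ _⊕_ c↦x d↦y)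

span-there : ∀ {m} {S : List (Z2^ m)} t x → Span S x → Span (t ∷ S) x
span-there t x (c , c↦x) = false ∷ c , trans (cong (_⊕ _) (·-zero t)) (trans (⊕-identityˡ _) c↦x)

span-∈ : ∀ {m} {S : List (Z2^ m)} {s} → s ∈ S → Span S s
span-∈ {S = t ∷ S} (here refl) =
  true ∷ replicate _ false , trans (cong₂ _⊕_ (·-one t) (lincomb-zero S)) (⊕-identityʳ t)
span-∈ {S = t ∷ S} {s} (there s∈S) = span-there t s (span-∈ s∈S)

unit : ∀ {m} → Fin m → Z2^ m
unit Fin.zero    = true ∷ zeroV
unit (Fin.suc k) = false ∷ unit k

unit-induction : ∀ {m} (P : Z2^ m → Set) → P zeroV → (∀ x y → P x → P y → P (x ⊕ y))
  → (∀ k → P (unit k)) → ∀ x → P x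
unit-induction P p0 p⊕ punit []      = p0
unit-induction P p0 p⊕ punit (b ∷ x) = with-head b
  where
  tail-only : P (false ∷ x)
  tail-only = unit-induction (P ∘ (false ∷_)) p0 (λ y z → p⊕ (false ∷ y) (false ∷ z)) (punit ∘ Fin.suc) x
  with-head : ∀ b → P (b ∷ x)
  with-head false = tail-only
  with-head true  = subst P (cong (true ∷_) (⊕-identityˡ x)) (p⊕ _ _ (punit Fin.zero) tail-only)

-- Potentials: coding vectors are differences of vertex potentials.

<ᵇ-suc : ∀ a b → (a <ᵇ suc b) ≡ (a ≤ᵇ b)
<ᵇ-suc zero    b = refl
<ᵇ-suc (suc a) b = refl

onesFrom : ∀ {m} → Fin (suc m) → Z2^ m
onesFrom {m}     Fin.zero    = replicate m true
onesFrom {suc m} (Fin.suc r) = false ∷ onesFrom r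

ω : ∀ {m} → Fin (suc m) → Z2^ m
ω v = onesFrom (opposite v)

ω∘opposite : ∀ {m} (r : Fin (suc m)) → ω (opposite r) ≡ onesFrom r
ω∘opposite r = cong onesFrom (Finₚ.opposite-involutive r)

lookup-onesFrom : ∀ {m} (r : Fin (suc m)) (k : Fin m) → lookup (onesFrom r) k ≡ (toℕ r ≤ᵇ toℕ k)
lookup-onesFrom             Fin.zero    k           = Vecₚ.lookup-replicate k true
lookup-onesFrom {suc m}     (Fin.suc r) Fin.zero    = refl
lookup-onesFrom {suc m}     (Fin.suc r) (Fin.suc k) = trans (lookup-onesFrom r k) (sym (<ᵇ-suc (toℕ r) (toℕ k)))

unit≡onesFrom⊕ : ∀ {m} (k : Fin m) → unit k ≡ onesFrom (inject₁ k) ⊕ onesFrom (Fin.suc k)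
unit≡onesFrom⊕ {suc m} Fin.zero    = cong (true ∷_) (sym (⊕-self (replicate m true)))
unit≡onesFrom⊕         (Fin.suc k) = cong (false ∷_) (unit≡onesFrom⊕ k)

fsharp≡ω⊕ω : ∀ {m} (i j : Fin (suc m)) → j < i → fsharp i j ≡ ω i ⊕ ω j
fsharp≡ω⊕ω {m} i j j<i = trans (Vecₚ.tabulate-cong coordinate) (Vecₚ.tabulate∘lookup (ω i ⊕ ω j))
  where
  a = toℕ i
  b = toℕ j
  suc[m∸a] : suc m ∸ a ≡ suc (m ∸ a)
  suc[m∸a] = ℕₚ.+-∸-assoc 1 (ℕ.≤-pred (Finₚ.toℕ<n i))
  ω-coordinate : ∀ v k → lookup (ω v) k ≡ (m ∸ toℕ v ≤ᵇ toℕ k)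
  ω-coordinate v k = trans (lookup-onesFrom (opposite v) k) (cong (_≤ᵇ toℕ k) (Finₚ.opposite-prop v))
  <ᵇ≡not≤ᵇ : ∀ k x → (k <ᵇ x) ≡ not (x ≤ᵇ k)
  <ᵇ≡not≤ᵇ k       zero    = refl
  <ᵇ≡not≤ᵇ zero    (suc x) = refl
  <ᵇ≡not≤ᵇ (suc k) (suc x) = trans (<ᵇ≡not≤ᵇ k x) (cong not (sym (<ᵇ-suc x k)))
  nested : ∀ k → (m ∸ b ≤ᵇ k) ≡ true → (m ∸ a ≤ᵇ k) ≡ true
  nested k h = Equivalence.to T-≡
    (ℕₚ.≤⇒≤ᵇ (ℕₚ.≤-trans (ℕₚ.∸-monoʳ-≤ m (ℕₚ.<⇒≤ j<i)) (ℕₚ.≤ᵇ⇒≤ _ _ (Equivalence.from T-≡ h))))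
  coordinate : ∀ k → ((suc m ∸ a ≤ᵇ suc (toℕ k)) ∧ (suc (toℕ k) ≤ᵇ m ∸ b)) ≡ lookup (ω i ⊕ ω j) k
  coordinate k = sym (begin
    lookup (ω i ⊕ ω j) k                          ≡⟨ Vecₚ.lookup-zipWith _xor_ k (ω i) (ω j) ⟩
    lookup (ω i) k xor lookup (ω j) k             ≡⟨ cong₂ _xor_ (ω-coordinate i k) (ω-coordinate j k) ⟩
    (m ∸ a ≤ᵇ toℕ k) xor (m ∸ b ≤ᵇ toℕ k)         ≡⟨ sym (∧-not≡xor _ _ (nested (toℕ k))) ⟩
    (m ∸ a ≤ᵇ toℕ k) ∧ not (m ∸ b ≤ᵇ toℕ k)       ≡⟨ cong₂ _∧_ (trans (sym (<ᵇ-suc (m ∸ a) (toℕ k))) (cong (_≤ᵇ suc (toℕ k)) (sym suc[m∸a])))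
                                                               (sym (<ᵇ≡not≤ᵇ (toℕ k) (m ∸ b))) ⟩
    (suc m ∸ a ≤ᵇ suc (toℕ k)) ∧ (suc (toℕ k) ≤ᵇ m ∸ b) ∎)

-- Vertex colourings as linear functionals.

-- the functional of a colouring χ of the vertices listed in step order:
-- coordinate k is weighted by whether χ changes between steps k and k+1
φ : ∀ {m} → (Fin (suc m) → Bool) → Z2^ m → Bool
φ χ []      = false
φ χ (b ∷ x) = (b ∧ (χ Fin.zero xor χ (Fin.suc Fin.zero))) xor φ (χ ∘ Fin.suc) x

φ-zero : ∀ {m} (χ : Fin (suc m) → Bool) → φ χ zeroV ≡ false
φ-zero {zero}  χ = refl
φ-zero {suc m} χ = φ-zero (χ ∘ Fin.suc)

φ-⊕ : ∀ {m} (χ : Fin (suc m) → Bool) (x y : Z2^ m) → φ χ (x ⊕ y) ≡ φ χ x xor φ χ y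
φ-⊕ χ []      []      = refl
φ-⊕ χ (a ∷ x) (b ∷ y) =
  trans (cong (((a xor b) ∧ _) xor_) (φ-⊕ (χ ∘ Fin.suc) x y)) (sym (xor-∧-interchange a b _ _ _))

φ-· : ∀ {m} (χ : Fin (suc m) → Bool) c (x : Z2^ m) → φ χ (c · x) ≡ c ∧ φ χ x
φ-· χ c []      = sym (∧-zeroʳ c)
φ-· χ c (a ∷ x) = trans (cong (((c ∧ a) ∧ _) xor_) (φ-· (χ ∘ Fin.suc) c x)) (∧-factor c a _ _)

-- on a step vector the weights telescope to the change of χ from step r to the end
φ-onesFrom : ∀ {m} (χ : Fin (suc m) → Bool) r → φ χ (onesFrom r) ≡ χ r xor χ (fromℕ m)
φ-onesFrom {zero}  χ Fin.zero    = sym (xor-same (χ Fin.zero))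
φ-onesFrom {suc m} χ Fin.zero    =
  trans (cong ((χ Fin.zero xor χ (Fin.suc Fin.zero)) xor_) (φ-onesFrom (χ ∘ Fin.suc) Fin.zero))
        (xor-telescope (χ Fin.zero) (χ (Fin.suc Fin.zero)) (χ (Fin.suc (fromℕ m))))
φ-onesFrom {suc m} χ (Fin.suc r) = φ-onesFrom (χ ∘ Fin.suc) r

-- the same functional with the vertices in their own order
Φ : ∀ {m} → (Fin (suc m) → Bool) → Z2^ m → Bool
Φ χ = φ (χ ∘ opposite)

Φ-code : ∀ {m} (χ : Fin (suc m) → Bool) u v → Φ χ (ω u ⊕ ω v) ≡ χ u xor χ v
Φ-code {m} χ u v = begin
  Φ χ (ω u ⊕ ω v)                   ≡⟨ φ-⊕ (χ ∘ opposite) (ω u) (ω v) ⟩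
  Φ χ (ω u) xor Φ χ (ω v)           ≡⟨ cong₂ _xor_ (Φ-ω u) (trans (Φ-ω v) (xor-comm (χ v) c)) ⟩
  (χ u xor c) xor (c xor χ v)       ≡⟨ xor-telescope (χ u) c (χ v) ⟩
  χ u xor χ v                       ∎
  where
  c = χ (opposite (fromℕ m))
  Φ-ω : ∀ w → Φ χ (ω w) ≡ χ w xor c
  Φ-ω w = trans (φ-onesFrom (χ ∘ opposite) (opposite w))
                (cong (λ z → χ z xor c) (Finₚ.opposite-involutive w))

Φ-lincomb : ∀ {m} (χ : Fin (suc m) → Bool) {S : List (Z2^ m)}
  → All (λ s → Φ χ s ≡ false) S → ∀ c → Φ χ (lincomb S c) ≡ false
Φ-lincomb χ []                []      = φ-zero (χ ∘ opposite)
Φ-lincomb χ {s ∷ S} (Φs≡0 ∷ Φ[S]≡0) (b ∷ c) = begin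
  Φ χ ((b · s) ⊕ lincomb S c)          ≡⟨ φ-⊕ (χ ∘ opposite) (b · s) (lincomb S c) ⟩
  Φ χ (b · s) xor Φ χ (lincomb S c)    ≡⟨ cong₂ _xor_ (φ-· (χ ∘ opposite) b s) (Φ-lincomb χ Φ[S]≡0 c) ⟩
  (b ∧ Φ χ s) xor false                ≡⟨ cong (λ t → (b ∧ t) xor false) Φs≡0 ⟩
  (b ∧ false) xor false                ≡⟨ cong (_xor false) (∧-zeroʳ b) ⟩
  false                                ∎

-- the colouring marking x separates a from b, so x is one of them
code-endpoint : ∀ {m} {x y a b : Fin (suc m)} → x ≢ y → ω x ⊕ ω y ≡ ω a ⊕ ω b → x ≡ a ⊎ x ≡ b
code-endpoint {x = x} {y} {a} {b} x≢y same with xor-true (is-x a) (is-x b) separates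
  where
  is-x : Fin _ → Bool
  is-x z = does (x ≟ z)
  separates : is-x a xor is-x b ≡ true
  separates = begin
    is-x a xor is-x b       ≡⟨ sym (Φ-code is-x a b) ⟩
    Φ is-x (ω a ⊕ ω b)      ≡⟨ cong (Φ is-x) (sym same) ⟩
    Φ is-x (ω x ⊕ ω y)      ≡⟨ Φ-code is-x x y ⟩
    is-x x xor is-x y       ≡⟨ cong₂ _xor_ (dec-true (x ≟ x) refl) (dec-false (x ≟ y) x≢y) ⟩
    true                    ∎
... | inj₁ x≡a = inj₁ (witness (x ≟ a) x≡a)
... | inj₂ x≡b = inj₂ (witness (x ≟ b) x≡b)

code-pair : ∀ {m} {x y a b : Fin (suc m)} → x ≢ y → ω x ⊕ ω y ≡ ω a ⊕ ω b
  → (x ≡ a × y ≡ b) ⊎ (x ≡ b × y ≡ a)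
code-pair {x = x} {y} x≢y same
  with code-endpoint x≢y same | code-endpoint (≢-sym x≢y) (trans (⊕-comm (ω y) (ω x)) same)
... | inj₁ x≡a | inj₂ y≡b = inj₁ (x≡a , y≡b)
... | inj₂ x≡b | inj₁ y≡a = inj₂ (x≡b , y≡a)
... | inj₁ x≡a | inj₁ y≡a = ⊥-elim (x≢y (trans x≡a (sym y≡a)))
... | inj₂ x≡b | inj₂ y≡b = ⊥-elim (x≢y (trans x≡b (sym y≡b)))

GS⇒code : ∀ {m} {S : List (Z2^ m)} {u v} → GS S u v → u ≢ v × (ω u ⊕ ω v) ∈ S
GS⇒code {S = S} {u} {v} (inj₁ (v<u , mem)) =
  ≢-sym (Finₚ.<⇒≢ v<u) , subst (_∈ S) (fsharp≡ω⊕ω u v v<u) mem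
GS⇒code {S = S} {u} {v} (inj₂ (u<v , mem)) =
  Finₚ.<⇒≢ u<v , subst (_∈ S) (trans (fsharp≡ω⊕ω v u u<v) (⊕-comm (ω v) (ω u))) mem

code⇒GS : ∀ {m} {S : List (Z2^ m)} {u v} → u ≢ v → (ω u ⊕ ω v) ∈ S → GS S u v
code⇒GS {S = S} {u} {v} u≢v mem with Finₚ.<-cmp u v
... | tri< u<v _ _ = inj₂ (u<v , subst (_∈ S) (sym (trans (fsharp≡ω⊕ω v u u<v) (⊕-comm (ω v) (ω u)))) mem)
... | tri≈ _ u≡v _ = ⊥-elim (u≢v u≡v)
... | tri> _ _ v<u = inj₁ (v<u , subst (_∈ S) (sym (fsharp≡ω⊕ω u v v<u)) mem)

GS-sym : ∀ {m} {S : List (Z2^ m)} {u v} → GS S u v → GS S v u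
GS-sym (inj₁ e) = inj₂ e
GS-sym (inj₂ e) = inj₁ e

GS-mono : ∀ {m} {S T : List (Z2^ m)} → S ⊆ T → ∀ {u v} → GS S u v → GS T u v
GS-mono S⊆T (inj₁ (v<u , mem)) = inj₁ (v<u , S⊆T mem)
GS-mono S⊆T (inj₂ (u<v , mem)) = inj₂ (u<v , S⊆T mem)

IsEdgeCode : ∀ {m} → Z2^ m → Set
IsEdgeCode {m} s = ∃[ i ] ∃[ j ] (i ≢ j × s ≡ ω {m} i ⊕ ω j)

-- Walks give spans, hence S spans when G(S) is connected.

walk-span : ∀ {m} {S : List (Z2^ m)} {u v} → Star (GS S) u v → Span S (ω u ⊕ ω v)
walk-span {S = S} {u} ε = subst (Span S) (sym (⊕-self (ω u))) (span-zero S)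
walk-span {S = S} {u} {v} (_◅_ {j = w} edge walk) =
  subst (Span S) (⊕-telescope (ω u) (ω w) (ω v))
        (span-⊕ S _ _ (span-∈ (proj₂ (GS⇒code edge))) (walk-span walk))

unit≡code : ∀ {m} (k : Fin m) → unit k ≡ ω (opposite (inject₁ k)) ⊕ ω (opposite (Fin.suc k))
unit≡code k = trans (unit≡onesFrom⊕ k) (sym (cong₂ _⊕_ (ω∘opposite (inject₁ k)) (ω∘opposite (Fin.suc k))))

connected⇒spanning : ∀ {m} {S : List (Z2^ m)} → Connected (GS S) → Spans S
connected⇒spanning {S = S} connected = unit-induction (Span S) (span-zero S) (span-⊕ S) unit-spanned
  where
  unit-spanned : ∀ k → Span S (unit k)
  unit-spanned k = subst (Span S) (sym (unit≡code k))
                         (walk-span (connected (opposite (inject₁ k)) (opposite (Fin.suc k))))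

module Components {n : ℕ} where

  relabel : Fin n → Fin n → Fin n → Fin n
  relabel new old a = if does (a ≟ old) then new else a

  -- a representative of the component of each vertex
  component : List (Fin n × Fin n) → Fin n → Fin n
  component []             x = x
  component ((i , j) ∷ es) x = relabel (component es i) (component es j) (component es x)

  component-edges : ∀ es → All (uncurry (λ i j → component es i ≡ component es j)) es
  component-edges []             = []
  component-edges ((i , j) ∷ es) =
    trans relabel-new (sym relabel-old) ∷ All.map (cong (relabel (component es i) (component es j))) (component-edges es)
    where
    relabel-new : relabel (component es i) (component es j) (component es i) ≡ component es i
    relabel-new with component es i ≟ component es j
    ... | yes _ = refl
    ... | no  _ = refl
    relabel-old : relabel (component es i) (component es j) (component es j) ≡ component es i
    relabel-old = cong (if_then component es i else component es j) (dec-true (component es j ≟ component es j) refl)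

  component-walk : ∀ {R : Fin n → Fin n → Set} → (∀ {u v} → R u v → R v u)
    → ∀ es → All (uncurry R) es → ∀ x y → component es x ≡ component es y → Star R x y
  component-walk R-sym []             _           x y refl = ε
  component-walk R-sym ((i , j) ∷ es) (rij ∷ R[es]) x y same
    with component es x ≟ component es j | component es y ≟ component es j
  ... | yes xj | yes yj = component-walk R-sym es R[es] x y (trans xj (sym yj))
  ... | yes xj | no  _  = component-walk R-sym es R[es] x j xj
                          ◅◅ (R-sym rij ◅ component-walk R-sym es R[es] i y same)
  ... | no  _  | yes yj = component-walk R-sym es R[es] x i same
                          ◅◅ (rij ◅ component-walk R-sym es R[es] j y (sym yj))
  ... | no  _  | no  _  = component-walk R-sym es R[es] x y same

open Components using (component; component-edges; component-walk)

-- Spans give walks.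

endpoints : ∀ {m} {S : List (Z2^ m)} → All IsEdgeCode S → List (Fin (suc m) × Fin (suc m))
endpoints []                  = []
endpoints ((i , j , _) ∷ cs) = (i , j) ∷ endpoints cs

endpoints-adjacent : ∀ {m} {S T : List (Z2^ m)} (cs : All IsEdgeCode S) → S ⊆ T
  → All (uncurry (GS T)) (endpoints cs)
endpoints-adjacent []                          _   = []
endpoints-adjacent ((i , j , i≢j , refl) ∷ cs) S⊆T =
  code⇒GS i≢j (S⊆T (here refl)) ∷ endpoints-adjacent cs (S⊆T ∘ there)

constant⇒vanishing : ∀ {m} (χ : Fin (suc m) → Bool) {S : List (Z2^ m)} (cs : All IsEdgeCode S)
  → All (uncurry (λ i j → χ i ≡ χ j)) (endpoints cs) → All (λ s → Φ χ s ≡ false) S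
constant⇒vanishing χ []                        []               = []
constant⇒vanishing χ ((i , j , _ , refl) ∷ cs) (χi≡χj ∷ χ-const) =
  trans (Φ-code χ i j) (trans (cong (_xor χ j) χi≡χj) (xor-same (χ j))) ∷ constant⇒vanishing χ cs χ-const

-- colour the component of u: it kills the span of S, so it cannot separate u from v
span⇒walk : ∀ {m} {S : List (Z2^ m)} → All IsEdgeCode S → ∀ u v → Span S (ω u ⊕ ω v) → Star (GS S) u v
span⇒walk {S = S} cs u v (c , c↦code) =
  component-walk GS-sym es (endpoints-adjacent cs id) u v (sym (witness (C v ≟ C u) χv≡true))
  where
  es = endpoints cs
  C = component es
  χ : Fin _ → Bool
  χ z = does (C z ≟ C u)
  χu≡χv : χ u ≡ χ v
  χu≡χv = xor-false⇒≡ (χ u) (χ v) (begin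
    χ u xor χ v          ≡⟨ sym (Φ-code χ u v) ⟩
    Φ χ (ω u ⊕ ω v)      ≡⟨ cong (Φ χ) (sym c↦code) ⟩
    Φ χ (lincomb S c)    ≡⟨ Φ-lincomb χ (constant⇒vanishing χ cs
                              (All.map (cong (λ l → does (l ≟ C u))) (component-edges es))) c ⟩
    false                ∎)
  χv≡true : χ v ≡ true
  χv≡true = trans (sym χu≡χv) (dec-true (C u ≟ C u) refl)

Irredundant : ∀ {m} → List (Z2^ m) → Set
Irredundant S = ∀ S₁ s S₂ → S ≡ S₁ ++ s ∷ S₂ → ¬ Span (S₁ ++ S₂) s

insert : ∀ {m} (S₁ : List (Z2^ m)) {s S₂} → Vec Bool (length (S₁ ++ S₂)) → Bool → Vec Bool (length (S₁ ++ s ∷ S₂))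
insert []       c       b = b ∷ c
insert (_ ∷ S₁) (a ∷ c) b = a ∷ insert S₁ c b

lincomb-insert : ∀ {m} (S₁ : List (Z2^ m)) {s S₂} c b
  → lincomb (S₁ ++ s ∷ S₂) (insert S₁ c b) ≡ (b · s) ⊕ lincomb (S₁ ++ S₂) c
lincomb-insert []       c       b = refl
lincomb-insert (x ∷ S₁) {s} (a ∷ c) b =
  trans (cong ((a · x) ⊕_) (lincomb-insert S₁ c b)) (⊕-swap (a · x) (b · s) _)

insert-nonzero : ∀ {m} (S₁ : List (Z2^ m)) {s S₂} c → insert S₁ {s} {S₂} c true ≢ replicate _ false
insert-nonzero []       c       ()
insert-nonzero (_ ∷ S₁) (a ∷ c) eq = insert-nonzero S₁ c (cong tail eq)

independent⇒irredundant : ∀ {m} {S : List (Z2^ m)} → LinearlyIndependent S → Irredundant S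
independent⇒irredundant independent S₁ s S₂ refl (c , c↦s) =
  insert-nonzero S₁ c (independent (insert S₁ c true) (begin
    lincomb (S₁ ++ s ∷ S₂) (insert S₁ c true)  ≡⟨ lincomb-insert S₁ c true ⟩
    (true · s) ⊕ lincomb (S₁ ++ S₂) c          ≡⟨ cong₂ _⊕_ (·-one s) c↦s ⟩
    s ⊕ s                                      ≡⟨ ⊕-self s ⟩
    zeroV                                      ∎))

irredundant⇒independent : ∀ {m} (S : List (Z2^ m)) → Irredundant S → LinearlyIndependent S
irredundant⇒independent []      _          []          _ = refl
irredundant⇒independent (s ∷ S) irredundant (true ∷ c) s+c↦0 =
  ⊥-elim (irredundant [] s S refl (c , sym (⊕-cancel s (lincomb S c) (trans (cong (_⊕ _) (sym (·-one s))) s+c↦0))))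
irredundant⇒independent (s ∷ S) irredundant (false ∷ c) c↦0 =
  cong (false ∷_) (irredundant⇒independent S irredundant-tail c
    (trans (sym (⊕-identityˡ _)) (trans (cong (_⊕ _) (sym (·-zero s))) c↦0)))
  where
  irredundant-tail : Irredundant S
  irredundant-tail S₁ t S₂ eq t∈span = irredundant (s ∷ S₁) t S₂ (cong (s ∷_) eq) (span-there s t t∈span)

-- a walk from x to z listing the vertices after x
data Path {V : Set} (R : V → V → Set) : V → List V → V → Set where
  stop : ∀ {x} → Path R x [] x
  step : ∀ {x y ys z} → R x y → Path R y ys z → Path R x (y ∷ ys) z

path-map : ∀ {V : Set} {R R′ : V → V → Set} → (∀ {a b} → R a b → R′ a b)
  → ∀ {x ys z} → Path R x ys z → Path R′ x ys z
path-map f stop          = stop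
path-map f (step r path) = step (f r) (path-map f path)

module _ {V : Set} (_≟ᵥ_ : DecidableEquality V) {R : V → V → Set} where

  suffix : ∀ {x y ys z} → x ∈ (y ∷ ys) → Path R y ys z → Unique (y ∷ ys)
    → ∃[ zs ] (Path R x zs z × Unique (x ∷ zs))
  suffix (here refl) path          uniq       = _ , path , uniq
  suffix (there x∈)  (step _ path) (_ ∷ uniq) = suffix x∈ path uniq

  shortcut : ∀ {x z} → Star R x z → ∃[ zs ] (Path R x zs z × Unique (x ∷ zs))
  shortcut ε = [] , stop , [] ∷ []
  shortcut {x} (_◅_ {j = y} r walk) with shortcut walk
  ... | ys , path , uniq with any? (x ≟ᵥ_) (y ∷ ys)
  ...   | yes x∈ = suffix x∈ path uniq
  ...   | no  x∉ = y ∷ ys , step r path , ¬Any⇒All¬ _ x∉ ∷ uniq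

path-close : ∀ {V : Set} {R : V → V → Set} {x ys z w} → Path R x ys z → R z w → Linked R (x ∷ ys ++ [ w ])
path-close stop          r = r ∷ [-]
path-close (step r′ path) r = r′ ∷ path-close path r

linked⇒walk : ∀ {V : Set} {R R′ : V → V → Set} {P : V → Set} {x} xs {z} → All P (x ∷ xs)
  → (∀ {u w} → P u → R u w → R′ u w) → Linked R (x ∷ xs ++ [ z ]) → Star R′ x z
linked⇒walk []       (p ∷ _)  f (r ∷ [-]) = f p r ◅ ε
linked⇒walk (_ ∷ xs) (p ∷ ps) f (r ∷ rs)  = f p r ◅ linked⇒walk xs ps f rs

∈-skip : ∀ {A : Set} (S₁ : List A) {s S₂ t} → t ∈ S₁ ++ S₂ → t ∈ S₁ ++ s ∷ S₂
∈-skip S₁ t∈ with ∈-++⁻ S₁ t∈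
... | inj₁ t∈S₁ = ∈-++⁺ˡ t∈S₁
... | inj₂ t∈S₂ = ∈-++⁺ʳ S₁ (there t∈S₂)

∈-remove : ∀ {A : Set} (S₁ : List A) {s S₂ t} → t ∈ S₁ ++ s ∷ S₂ → t ≢ s → t ∈ S₁ ++ S₂
∈-remove S₁ t∈ t≢s with ∈-++⁻ S₁ t∈
... | inj₁ t∈S₁         = ∈-++⁺ˡ t∈S₁
... | inj₂ (here t≡s)   = ⊥-elim (t≢s t≡s)
... | inj₂ (there t∈S₂) = ∈-++⁺ʳ S₁ t∈S₂

unique-removed : ∀ {A : Set} (S₁ : List A) {s S₂} → Unique (S₁ ++ s ∷ S₂) → s ∉ S₁ ++ S₂
unique-removed []       (s∉S₂ ∷ _)  s∈          = All.lookup s∉S₂ s∈ refl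
unique-removed (x ∷ S₁) (x∉ ∷ _)    (here s≡x)  = All.lookup x∉ (∈-insert S₁) (sym s≡x)
unique-removed (x ∷ S₁) (_ ∷ uniq)  (there s∈)  = unique-removed S₁ uniq s∈

drop-edge : ∀ {m} (S₁ S₂ : List (Z2^ m)) {a b x y} → a ≢ x → b ≢ x
  → GS (S₁ ++ (ω a ⊕ ω b) ∷ S₂) x y → GS (S₁ ++ S₂) x y
drop-edge S₁ S₂ {a} {b} {x} {y} a≢x b≢x edge = code⇒GS x≢y (∈-remove S₁ mem other-code)
  where
  x≢y = proj₁ (GS⇒code edge)
  mem = proj₂ (GS⇒code edge)
  other-code : ω x ⊕ ω y ≢ ω a ⊕ ω b
  other-code same with code-endpoint x≢y same
  ... | inj₁ x≡a = a≢x (sym x≡a)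
  ... | inj₂ x≡b = b≢x (sym x≡b)

-- a vector of S spanned by the others is an edge i–j joined by a walk avoiding it;
-- shortcut to a simple path, this closes up into a cycle unless it is that very edge
acyclic⇒irredundant : ∀ {m} {S : List (Z2^ m)} → All IsEdgeCode S → Unique S → Acyclic (GS S) → Irredundant S
acyclic⇒irredundant codes uniq acyclic S₁ s S₂ refl s∈span with All.lookup codes (∈-insert S₁)
... | i , j , i≢j , refl
    with shortcut _≟_ (span⇒walk (All.tabulate (All.lookup codes ∘ ∈-skip S₁)) i j s∈span)
... | []            , stop             , _     = i≢j refl
... | _ ∷ []        , step edge stop   , _     = unique-removed S₁ uniq (proj₂ (GS⇒code edge))
... | y₁ ∷ y₂ ∷ ys , path             , uniq′ =
  acyclic (i ∷ y₁ ∷ y₂ ∷ ys) (uniq′ , path-close (path-map (GS-mono (∈-skip S₁)) path) closing)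
  where
  closing : GS (S₁ ++ (ω i ⊕ ω j) ∷ S₂) j i
  closing = code⇒GS (≢-sym i≢j) (subst (_∈ S₁ ++ (ω i ⊕ ω j) ∷ S₂) (⊕-comm (ω i) (ω j)) (∈-insert S₁))

-- the rest of a cycle v₀ v₁ … vₖ is a walk v₁ → v₀ avoiding the edge v₀–v₁,
-- so the code of that edge is spanned by the other vectors
independent⇒acyclic : ∀ {m} {S : List (Z2^ m)} → LinearlyIndependent S → Acyclic (GS S)
independent⇒acyclic _ [] ()
independent⇒acyclic _ (_ ∷ []) ()
independent⇒acyclic _ (_ ∷ _ ∷ []) ()
independent⇒acyclic independent (v₀ ∷ v₁ ∷ v₂ ∷ vs) ((v₀∉ ∷ v₁∉ ∷ _) , (e₀₁ ∷ e₁₂ ∷ rest))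
  with ∈-∃++ (proj₂ (GS⇒code e₀₁))
... | S₁ , S₂ , refl =
  independent⇒irredundant independent S₁ (ω v₀ ⊕ ω v₁) S₂ refl
    (subst (Span (S₁ ++ S₂)) (⊕-comm (ω v₁) (ω v₀)) (walk-span walk))
  where
  off-edge : All (λ x → v₀ ≢ x × v₁ ≢ x) (v₂ ∷ vs)
  off-edge = All.zip (All.tail v₀∉ , v₁∉)
  walk : Star (GS (S₁ ++ S₂)) v₁ v₀
  walk = GS-sym (drop-edge S₁ S₂ (All.head (All.tail v₀∉)) (All.head v₁∉) (GS-sym e₁₂))
       ◅ linked⇒walk vs off-edge (λ off → drop-edge S₁ S₂ (proj₁ off) (proj₂ off)) rest

coding⇒edge-code : ∀ {V : Set} {m} {G : SimpleGraph V} {σ : Fin (suc m) ↔ V} {s}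
  → InCoding G σ s → IsEdgeCode s
coding⇒edge-code (i , j , j<i , _ , s≡) = i , j , ≢-sym (Finₚ.<⇒≢ j<i) , trans s≡ (fsharp≡ω⊕ω i j j<i)

GS⊆G : ∀ {V : Set} {m} (G : SimpleGraph V) (σ : Fin (suc m) ↔ V) {S : List (Z2^ m)}
  → All (InCoding G σ) S → ∀ u v → GS S u v → LAdj G σ u v
GS⊆G G σ coded u v edge with GS⇒code edge
... | u≢v , mem with All.lookup coded mem
... | i , j , j<i , adj , s≡ with code-pair {a = i} {b = j} u≢v (trans s≡ (fsharp≡ω⊕ω i j j<i))
... | inj₁ (refl , refl) = adj
... | inj₂ (refl , refl) = SimpleGraph.sym G adj

corollary6 : {V : Set} (m : ℕ) (G : SimpleGraph V) (σ : Fin (suc m) ↔ V)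
    → Connected (Adj G)
    → (S : List (Z2^ m)) → Unique S → All (InCoding G σ) S
    → IsSpanningTreeOf (GS S) (LAdj G σ) ⇔ IsBasis S
corollary6 m G σ _ S unique coded = mk⇔ tree⇒basis basis⇒tree
  where
  codes : All IsEdgeCode S
  codes = All.map (coding⇒edge-code {G = G} {σ = σ}) coded
  tree⇒basis : IsSpanningTreeOf (GS S) (LAdj G σ) → IsBasis S
  tree⇒basis (_ , connected , acyclic) =
    irredundant⇒independent S (acyclic⇒irredundant codes unique acyclic) , connected⇒spanning connected
  basis⇒tree : IsBasis S → IsSpanningTreeOf (GS S) (LAdj G σ)
  basis⇒tree (independent , spans) =
    GS⊆G G σ coded , (λ u v → span⇒walk codes u v (spans (ω u ⊕ ω v))) , independent⇒acyclic independent
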